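{- Let $G$ be an abelian group, $\alpha,\beta\in G$, and let $\lambda$ be a partition with $k=|\lambda|\ge 1$ blocks. Then $s_{\alpha,\beta}(\lambda^{0j})=s_{\alpha,\beta}(\lambda)$ if $j\in\{0,1\}$, and $s_{\alpha,\beta}(\lambda^{0j})=s_{\alpha,\beta}(\lambda^{j-1})$ if $2\le j\le k+1$; and for $1\le i\le k$: $s_{\alpha,\beta}(\lambda^{ij})=s_{\alpha,\beta}(\lambda^{i})$ if $j\in\{0,1\}$; $s_{\alpha,\beta}(\lambda^{ij})=s_{\alpha,\beta}(\lambda^{i})+s_{\alpha,\beta}(\lambda^{j-1})-s_{\alpha,\beta}(\lambda^{1})+\alpha$ if $2\le j\le i$; $s_{\alpha,\beta}(\lambda^{ij})=s_{\alpha,\beta}(\lambda^{i})+s_{\alpha,\beta}(\lambda^{j})-s_{\alpha,\beta}(\lambda^{1})+\beta$ if $i+1\le j\le k$.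
   Context: A partition of $[n]$ is represented as a graph on $[n]$ whose arcs join consecutive elements of each block (a block $\{a_1<\dots<a_j\}$ gives arcs $(a_1,a_2),\dots,(a_{j-1},a_j)$). Two arcs $(i_1,j_1),(i_2,j_2)$ form a crossing if $i_1<i_2<j_1<j_2$ and a nesting if $i_1<i_2<j_2<j_1$; $cr$, $ne$ count them, and $s_{\alpha,\beta}(\pi)=cr(\pi)\alpha+ne(\pi)\beta$. For a partition $\lambda$ of $[n]$ with blocks $B_1,\dots,B_k$ ordered increasingly by their minimal elements, and $S+1=\{a+1:a\in S\}$, define the partitions of $[n+1]$: $\lambda^{0}=\{\{1\},B_1+1,\dots,B_k+1\}$, and for $1\le i\le k$, $\lambda^{i}=\{\{1\}\cup(B_i+1)\}\cup\{B_j+1: j\ne i\}$. Write $\lambda^{ij}=(\lambda^i)^j$ (note $\lambda^0$ has $k+1$ blocks and $\lambda^i$, $i\ge1$, has $k$ blocks). -}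

module Defs where

open import Level using (Level)
open import Data.Bool using (Bool; true; false; _∧_)
open import Data.Nat using (ℕ; zero; suc; _<_; _<ᵇ_)
open import Data.Product using (_×_; _,_)
open import Data.List using (List; []; _∷_; [_]; map; concat; concatMap; length; applyUpTo; cartesianProduct; filterᵇ)
open import Data.List.Relation.Unary.All using (All)
open import Data.List.Relation.Unary.Linked using (Linked)
open import Data.List.Relation.Binary.Permutation.Propositional using (_↭_)
open import Data.Empty using (⊥)
open import Relation.Binary.PropositionalEquality using (_≢_)
open import Algebra.Bundles using (AbelianGroup)

-- A partition of [n] = {1,…,n} is represented by the list of its blocks,
-- each block a strictly increasing list of elements, the blocks listed
-- increasingly by their minimal elements.
Block : Set
Block = List ℕ

Partition : Set
Partition = List Block

_<min_ : Block → Block → Set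
(x ∷ _) <min (y ∷ _) = x < y
_ <min _ = ⊥

record IsPartition (n : ℕ) (π : Partition) : Set where
  field
    nonempty   : All (λ b → b ≢ []) π
    increasing : All (Linked _<_) π
    ordered    : Linked _<min_ π
    covers     : concat π ↭ applyUpTo suc n

blockArcs : Block → List (ℕ × ℕ)
blockArcs (a ∷ b ∷ bs) = (a , b) ∷ blockArcs (b ∷ bs)
blockArcs _ = []

arcs : Partition → List (ℕ × ℕ)
arcs = concatMap blockArcs

crossingᵇ : (ℕ × ℕ) × (ℕ × ℕ) → Bool
crossingᵇ ((i₁ , j₁) , (i₂ , j₂)) = (i₁ <ᵇ i₂) ∧ (i₂ <ᵇ j₁) ∧ (j₁ <ᵇ j₂)

nestingᵇ : (ℕ × ℕ) × (ℕ × ℕ) → Bool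
nestingᵇ ((i₁ , j₁) , (i₂ , j₂)) = (i₁ <ᵇ i₂) ∧ (i₂ <ᵇ j₂) ∧ (j₂ <ᵇ j₁)

cr : Partition → ℕ
cr π = length (filterᵇ crossingᵇ (cartesianProduct (arcs π) (arcs π)))

ne : Partition → ℕ
ne π = length (filterᵇ nestingᵇ (cartesianProduct (arcs π) (arcs π)))

shift : Partition → Partition
shift = map (map suc)

-- i-th block (0-based) and the list with it removed (defaults if out of range)
nthBlock : ℕ → Partition → Block
nthBlock _       []       = []
nthBlock zero    (b ∷ _)  = b
nthBlock (suc i) (_ ∷ bs) = nthBlock i bs

removeBlock : ℕ → Partition → Partition
removeBlock _       []       = []
removeBlock zero    (_ ∷ bs) = bs
removeBlock (suc i) (b ∷ bs) = b ∷ removeBlock i bs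

-- ext i λ = λ^i  (blocks again ordered by minima: the block containing 1 first)
ext : ℕ → Partition → Partition
ext zero    π = [ 1 ] ∷ shift π
ext (suc i) π = (1 ∷ map suc (nthBlock i π)) ∷ shift (removeBlock i π)

module _ {c ℓ : Level} (G : AbelianGroup c ℓ) where
  open AbelianGroup G

  times : ℕ → Carrier → Carrier
  times zero    x = ε
  times (suc m) x = x ∙ times m x

  s : Carrier → Carrier → Partition → Carrier
  s α β π = times (cr π) α ∙ times (ne π) β

module Submission where

-- λ^0 only shifts every arc by one, while λ^i (i ≥ 1) also adds one arc, (1, m + 1) with m = min B_i, and an arc
-- starting at 1 can only be the first arc of a crossing or a nesting. So cr and ne each grow from λ to λ^i by the
-- number c(m) of such pairs that (1, m + 1) forms with the shifted arcs of λ, and c(min B_1) = 0. Extending λ^i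
-- once more by its block j ≥ 2, which is B_{j'} + 1 with j' = j - 1 if j ≤ i and j' = j otherwise, adds (1, m' + 2)
-- with m' = min B_{j'}; shifting twice does not change its pairs with the old arcs, so it contributes c(m') plus
-- the pair it forms with (1, m + 1), a crossing if m' < m and a nesting if m < m'. Hence
-- x(λ^{ij}) + x(λ^1) = x(λ^i) + x(λ^{j'}) + [new pair] for x = cr, ne, and the identity in G is a rearrangement.

open import Defs
open import Level using (Level)
open import Function using (_∘_; _⇔_; mk⇔; Equivalence)
open import Data.Bool using (Bool; true; false; T; _∧_)
open import Data.Bool.Properties using (T-∧)
open import Data.Nat using (ℕ; zero; suc; _+_; _∸_; _≤_; _<_; _<ᵇ_; z≤n; s≤s)
open import Data.Nat.Properties
  using (<ᵇ⇒<; <⇒<ᵇ; m≤n⇒m≤1+n; ≤-refl; ≤-trans; <-trans; <⇒≤; <⇒≱; <-asym)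
open import Data.Nat.ListAction using (sum)
open import Data.Nat.ListAction.Properties using (sum-↭)
open import Data.Nat.Tactic.RingSolver using (solve-∀)
open import Data.Product using (_×_; _,_; proj₁; proj₂; ∃₂)
open import Data.List using (List; []; _∷_; length; map; _++_; cartesianProduct; filterᵇ)
open import Data.List.Properties using (length-++; filter-++; map-++; map-cong; map-cong-local)
open import Data.List.Relation.Unary.All as All using (All; []; _∷_)
import Data.List.Relation.Unary.All.Properties as All
open import Data.List.Relation.Unary.Linked as Linked using (Linked; []; [-]; _∷_)
open import Data.List.Relation.Unary.Linked.Properties using (Linked⇒All)
open import Data.List.Relation.Binary.Permutation.Propositional
  using (_↭_; ↭-refl; ↭-trans; ↭-sym; ↭-reflexive; ↭-prep)
import Data.List.Relation.Binary.Permutation.Propositional.Properties as ↭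
open import Algebra.Bundles using (AbelianGroup)
open import Relation.Nullary using (¬_; contradiction)
open import Relation.Binary.PropositionalEquality
  using (_≡_; _≢_; refl; sym; trans; cong; cong₂; subst; module ≡-Reasoning)

indicator : Bool → ℕ
indicator false = 0
indicator true  = 1

indicator-T : ∀ {b} → T b → indicator b ≡ 1
indicator-T {true} _ = refl

indicator-¬T : ∀ {b} → ¬ T b → indicator b ≡ 0
indicator-¬T {false} _  = refl
indicator-¬T {true}  ¬t = contradiction _ ¬t

module PairCount {a} {A : Set a} (f : A × A → Bool) where
  open ≡-Reasoning

  rowCount : A → List A → ℕ
  rowCount x ys = sum (map (λ y → indicator (f (x , y))) ys)

  pairCount : List A → List A → ℕ
  pairCount xs ys = sum (map (λ x → rowCount x ys) xs)

  length-filter-map-pair : ∀ x ys → length (filterᵇ f (map (x ,_) ys)) ≡ rowCount x ys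
  length-filter-map-pair x []       = refl
  length-filter-map-pair x (y ∷ ys) with f (x , y)
  ... | true  = cong suc (length-filter-map-pair x ys)
  ... | false = length-filter-map-pair x ys

  length-filter-cartesianProduct : ∀ xs ys → length (filterᵇ f (cartesianProduct xs ys)) ≡ pairCount xs ys
  length-filter-cartesianProduct []       ys = refl
  length-filter-cartesianProduct (x ∷ xs) ys = begin
    length (filterᵇ f (map (x ,_) ys ++ cartesianProduct xs ys))
      ≡⟨ cong length (filter-++ _ (map (x ,_) ys) (cartesianProduct xs ys)) ⟩
    length (filterᵇ f (map (x ,_) ys) ++ filterᵇ f (cartesianProduct xs ys))
      ≡⟨ length-++ (filterᵇ f (map (x ,_) ys)) ⟩
    length (filterᵇ f (map (x ,_) ys)) + length (filterᵇ f (cartesianProduct xs ys))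
      ≡⟨ cong₂ _+_ (length-filter-map-pair x ys) (length-filter-cartesianProduct xs ys) ⟩
    rowCount x ys + pairCount xs ys ∎

  rowCount-↭ : ∀ x {ys zs} → ys ↭ zs → rowCount x ys ≡ rowCount x zs
  rowCount-↭ x p = sum-↭ (↭.map⁺ _ p)

  pairCount-↭ : ∀ {xs ys} → xs ↭ ys → pairCount xs xs ≡ pairCount ys ys
  pairCount-↭ {xs} {ys} p = begin
    sum (map (λ x → rowCount x xs) xs) ≡⟨ sum-↭ (↭.map⁺ _ p) ⟩
    sum (map (λ x → rowCount x xs) ys) ≡⟨ cong sum (map-cong (λ x → rowCount-↭ x p) ys) ⟩
    pairCount ys ys                    ∎

  rowCount-none : ∀ {x ys} → All (λ y → ¬ T (f (x , y))) ys → rowCount x ys ≡ 0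
  rowCount-none []          = refl
  rowCount-none (¬t ∷ ¬ts) = cong₂ _+_ (indicator-¬T ¬t) (rowCount-none ¬ts)

  pairCount-∷ʳ-none : ∀ {x xs ys} → All (λ y → ¬ T (f (y , x))) xs →
                      pairCount xs (x ∷ ys) ≡ pairCount xs ys
  pairCount-∷ʳ-none {ys = ys} ¬ts =
    cong sum (map-cong-local (All.map (λ {y} ¬t → cong (_+ rowCount y ys) (indicator-¬T ¬t)) ¬ts))

  pairCount-prepend : ∀ {x xs} → All (λ y → ¬ T (f (y , x))) (x ∷ xs) →
                      pairCount (x ∷ xs) (x ∷ xs) ≡ rowCount x xs + pairCount xs xs
  pairCount-prepend {x} {xs} (¬txx ∷ ¬ts) =
    cong₂ _+_ (cong (_+ rowCount x xs) (indicator-¬T ¬txx)) (pairCount-∷ʳ-none {ys = xs} ¬ts)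

  module _ (g : A → A) (invariant : ∀ p q → f (g p , g q) ≡ f (p , q)) where

    rowCount-map : ∀ x ys → rowCount (g x) (map g ys) ≡ rowCount x ys
    rowCount-map x []       = refl
    rowCount-map x (y ∷ ys) = cong₂ _+_ (cong indicator (invariant x y)) (rowCount-map x ys)

    pairCount-map : ∀ xs ys → pairCount (map g xs) (map g ys) ≡ pairCount xs ys
    pairCount-map []       ys = refl
    pairCount-map (x ∷ xs) ys = cong₂ _+_ (rowCount-map x ys) (pairCount-map xs ys)

open PairCount

Arc : Set
Arc = ℕ × ℕ

shiftArc : Arc → Arc
shiftArc (i , j) = suc i , suc j

blockArcs-map-suc : ∀ b → blockArcs (map suc b) ≡ map shiftArc (blockArcs b)
blockArcs-map-suc []          = refl
blockArcs-map-suc (x ∷ [])    = refl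
blockArcs-map-suc (x ∷ y ∷ b) = cong ((suc x , suc y) ∷_) (blockArcs-map-suc (y ∷ b))

arcs-shift : ∀ π → arcs (shift π) ≡ map shiftArc (arcs π)
arcs-shift []      = refl
arcs-shift (b ∷ π) = trans (cong₂ _++_ (blockArcs-map-suc b) (arcs-shift π))
                           (sym (map-++ shiftArc (blockArcs b) (arcs π)))

arcs-nthBlock-removeBlock : ∀ i π → blockArcs (nthBlock i π) ++ arcs (removeBlock i π) ↭ arcs π
arcs-nthBlock-removeBlock i       []      = ↭-refl
arcs-nthBlock-removeBlock zero    (b ∷ π) = ↭-refl
arcs-nthBlock-removeBlock (suc i) (b ∷ π) =
  ↭-trans (↭.shifts (blockArcs (nthBlock i π)) (blockArcs b))
          (↭.++⁺ˡ (blockArcs b) (arcs-nthBlock-removeBlock i π))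

arcs-ext-suc : ∀ i π {m t} → nthBlock i π ≡ m ∷ t →
               arcs (ext (suc i) π) ↭ (1 , suc m) ∷ map shiftArc (arcs π)
arcs-ext-suc i π {m} {t} eq = ↭-trans (↭-reflexive arcs-eq) (↭-prep (1 , suc m) (↭.map⁺ shiftArc perm))
  where
  open ≡-Reasoning
  R = removeBlock i π
  perm : blockArcs (m ∷ t) ++ arcs R ↭ arcs π
  perm = subst (λ b → blockArcs b ++ arcs R ↭ arcs π) eq (arcs-nthBlock-removeBlock i π)
  arcs-eq : arcs (ext (suc i) π) ≡ (1 , suc m) ∷ map shiftArc (blockArcs (m ∷ t) ++ arcs R)
  arcs-eq = begin
    blockArcs (1 ∷ map suc (nthBlock i π)) ++ arcs (shift R)
      ≡⟨ cong (λ b → blockArcs (1 ∷ map suc b) ++ arcs (shift R)) eq ⟩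
    (1 , suc m) ∷ blockArcs (map suc (m ∷ t)) ++ arcs (shift R)
      ≡⟨ cong ((1 , suc m) ∷_) (cong₂ _++_ (blockArcs-map-suc (m ∷ t)) (arcs-shift R)) ⟩
    (1 , suc m) ∷ map shiftArc (blockArcs (m ∷ t)) ++ map shiftArc (arcs R)
      ≡⟨ cong ((1 , suc m) ∷_) (map-++ shiftArc (blockArcs (m ∷ t)) (arcs R)) ⟨
    (1 , suc m) ∷ map shiftArc (blockArcs (m ∷ t) ++ arcs R) ∎

nthBlock-shift : ∀ k π → nthBlock k (shift π) ≡ map suc (nthBlock k π)
nthBlock-shift k       []      = refl
nthBlock-shift zero    (b ∷ π) = refl
nthBlock-shift (suc k) (b ∷ π) = nthBlock-shift k π

nthBlock-removeBlock-< : ∀ {k i} π → k < i → nthBlock k (removeBlock i π) ≡ nthBlock k π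
nthBlock-removeBlock-< []                      _         = refl
nthBlock-removeBlock-< {zero}  {suc i} (b ∷ π) _         = refl
nthBlock-removeBlock-< {suc k} {suc i} (b ∷ π) (s≤s k<i) = nthBlock-removeBlock-< π k<i

nthBlock-removeBlock-≥ : ∀ {k i} π → i ≤ k → nthBlock k (removeBlock i π) ≡ nthBlock (suc k) π
nthBlock-removeBlock-≥ []                      _         = refl
nthBlock-removeBlock-≥ {k}     {zero}  (b ∷ π) _         = refl
nthBlock-removeBlock-≥ {suc k} {suc i} (b ∷ π) (s≤s i≤k) = nthBlock-removeBlock-≥ π i≤k

nthBlock-nonempty : ∀ {π} → All (λ b → b ≢ []) π → ∀ {k} → k < length π →
                    ∃₂ λ m t → nthBlock k π ≡ m ∷ t
nthBlock-nonempty {[] ∷ π}      (b≢[] ∷ _) {zero}  _          = contradiction refl b≢[]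
nthBlock-nonempty {(m ∷ t) ∷ π} _          {zero}  _          = m , t , refl
nthBlock-nonempty {_ ∷ π}       (_ ∷ ne)   {suc k} (s≤s k<l) = nthBlock-nonempty ne k<l

head-<-nthBlock : ∀ {a s π i b t} → Linked _<min_ ((a ∷ s) ∷ π) → nthBlock i π ≡ b ∷ t → a < b
head-<-nthBlock {π = []}          _           ()
head-<-nthBlock {π = [] ∷ _}      (() ∷ _)    _
head-<-nthBlock {π = (c ∷ u) ∷ π} {zero}  (a<c ∷ _)   refl = a<c
head-<-nthBlock {π = (c ∷ u) ∷ π} {suc i} (a<c ∷ ord) eq   = <-trans a<c (head-<-nthBlock ord eq)

nthBlock-head-< : ∀ {π j i a s b t} → Linked _<min_ π → j < i →
                  nthBlock j π ≡ a ∷ s → nthBlock i π ≡ b ∷ t → a < b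
nthBlock-head-< {_ ∷ π} {zero}  {suc i} ord _         refl eq' = head-<-nthBlock ord eq'
nthBlock-head-< {_ ∷ π} {suc j} {suc i} ord (s≤s j<i) eq   eq' = nthBlock-head-< (Linked.tail ord) j<i eq eq'

All-nthBlock : ∀ {P : ℕ → Set} {π} k → All (All P) π → All P (nthBlock k π)
All-nthBlock k       []         = []
All-nthBlock zero    (pb ∷ _)   = pb
All-nthBlock (suc k) (_ ∷ pπ)   = All-nthBlock k pπ

All-arcs-start : ∀ {P : ℕ → Set} {π} → All (All P) π → All (P ∘ proj₁) (arcs π)
All-arcs-start = All.concat⁺ ∘ All.map⁺ ∘ All.map blockArcs-start
  where
  blockArcs-start : ∀ {P : ℕ → Set} {b} → All P b → All (P ∘ proj₁) (blockArcs b)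
  blockArcs-start {b = []}        _               = []
  blockArcs-start {b = _ ∷ []}    _               = []
  blockArcs-start {b = _ ∷ _ ∷ _} (px ∷ py ∷ pb) = px ∷ blockArcs-start (py ∷ pb)

elements-positive : ∀ {n π} → IsPartition n π → All (All (1 ≤_)) π
elements-positive {n} ip =
  All.concat⁻ (↭.All-resp-↭ (↭-sym (IsPartition.covers ip)) (All.applyUpTo⁺₁ suc n (λ _ → s≤s z≤n)))

elements-≥-first : ∀ {m t ρ} → All (Linked _<_) ((m ∷ t) ∷ ρ) → Linked _<min_ ((m ∷ t) ∷ ρ) →
                   All (All (m ≤_)) ((m ∷ t) ∷ ρ)
elements-≥-first = go ≤-refl
  where
  go : ∀ {m h t ρ} → m ≤ h → All (Linked _<_) ((h ∷ t) ∷ ρ) → Linked _<min_ ((h ∷ t) ∷ ρ) →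
       All (All (m ≤_)) ((h ∷ t) ∷ ρ)
  go m≤h (inc ∷ _) [-] = Linked⇒All ≤-trans m≤h (Linked.map <⇒≤ inc) ∷ []
  go {ρ = [] ∷ _} _ _ (() ∷ _)
  go {ρ = (_ ∷ _) ∷ _} m≤h (inc ∷ incs) (h<h' ∷ ord) =
    Linked⇒All ≤-trans m≤h (Linked.map <⇒≤ inc) ∷ go (≤-trans m≤h (<⇒≤ h<h')) incs ord

nthBlock-head-positive : ∀ {n π k m t} → IsPartition n π → nthBlock k π ≡ m ∷ t → 1 ≤ m
nthBlock-head-positive {k = k} ip eq =
  All.head (subst (All (1 ≤_)) eq (All-nthBlock k (elements-positive ip)))

T-<ᵇ³ : ∀ a b c d e g → T ((a <ᵇ b) ∧ (c <ᵇ d) ∧ (e <ᵇ g)) ⇔ (a < b × c < d × e < g)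
T-<ᵇ³ a b c d e g = mk⇔ to from
  where
  to : T ((a <ᵇ b) ∧ (c <ᵇ d) ∧ (e <ᵇ g)) → a < b × c < d × e < g
  to t with Equivalence.to (T-∧ {a <ᵇ b}) t
  ... | t₁ , t₂₃ with Equivalence.to (T-∧ {c <ᵇ d}) t₂₃
  ... | t₂ , t₃ = <ᵇ⇒< a b t₁ , <ᵇ⇒< c d t₂ , <ᵇ⇒< e g t₃
  from : a < b × c < d × e < g → T ((a <ᵇ b) ∧ (c <ᵇ d) ∧ (e <ᵇ g))
  from (p , q , r) =
    Equivalence.from (T-∧ {a <ᵇ b}) (<⇒<ᵇ p , Equivalence.from (T-∧ {c <ᵇ d}) (<⇒<ᵇ q , <⇒<ᵇ r))

record IsArcPattern (f : Arc × Arc → Bool) : Set where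
  field
    shift-invariant : ∀ p q → f (shiftArc p , shiftArc q) ≡ f (p , q)
    interleaving    : ∀ {i₁ j₁ i₂ j₂} → T (f ((i₁ , j₁) , (i₂ , j₂))) → i₁ < i₂ × i₂ < j₁
    -- the start of the first arc matters only through its order with the second start
    start-relative  : ∀ j₁ i₂ j₂ → f ((1 , j₁) , (3 + i₂ , j₂)) ≡ f ((2 , j₁) , (3 + i₂ , j₂))

crossing-isArcPattern : IsArcPattern crossingᵇ
crossing-isArcPattern = record
  { shift-invariant = λ _ _ → refl
  ; interleaving    = λ {i₁} {j₁} {i₂} {j₂} t →
      let i₁<i₂ , i₂<j₁ , _ = Equivalence.to (T-<ᵇ³ i₁ i₂ i₂ j₁ j₁ j₂) t
      in  i₁<i₂ , i₂<j₁
  ; start-relative  = λ _ _ _ → refl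
  }

nesting-isArcPattern : IsArcPattern nestingᵇ
nesting-isArcPattern = record
  { shift-invariant = λ _ _ → refl
  ; interleaving    = λ {i₁} {j₁} {i₂} {j₂} t →
      let i₁<i₂ , i₂<j₂ , j₂<j₁ = Equivalence.to (T-<ᵇ³ i₁ i₂ i₂ j₂ j₂ j₁) t
      in  i₁<i₂ , <-trans i₂<j₂ j₂<j₁
  ; start-relative  = λ _ _ _ → refl
  }

indicator-crossingᵇ-≡1 : ∀ {i₁ j₁ i₂ j₂} → i₁ < i₂ → i₂ < j₁ → j₁ < j₂ →
                         indicator (crossingᵇ ((i₁ , j₁) , (i₂ , j₂))) ≡ 1
indicator-crossingᵇ-≡1 {i₁} {j₁} {i₂} {j₂} p q r =
  indicator-T (Equivalence.from (T-<ᵇ³ i₁ i₂ i₂ j₁ j₁ j₂) (p , q , r))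

indicator-crossingᵇ-≡0 : ∀ {i₁ j₁ i₂ j₂} → j₂ < j₁ →
                         indicator (crossingᵇ ((i₁ , j₁) , (i₂ , j₂))) ≡ 0
indicator-crossingᵇ-≡0 {i₁} {j₁} {i₂} {j₂} j₂<j₁ =
  indicator-¬T (λ t → <-asym j₂<j₁ (proj₂ (proj₂ (Equivalence.to (T-<ᵇ³ i₁ i₂ i₂ j₁ j₁ j₂) t))))

indicator-nestingᵇ-≡1 : ∀ {i₁ j₁ i₂ j₂} → i₁ < i₂ → i₂ < j₂ → j₂ < j₁ →
                        indicator (nestingᵇ ((i₁ , j₁) , (i₂ , j₂))) ≡ 1
indicator-nestingᵇ-≡1 {i₁} {j₁} {i₂} {j₂} p q r =
  indicator-T (Equivalence.from (T-<ᵇ³ i₁ i₂ i₂ j₂ j₂ j₁) (p , q , r))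

indicator-nestingᵇ-≡0 : ∀ {i₁ j₁ i₂ j₂} → j₁ < j₂ →
                        indicator (nestingᵇ ((i₁ , j₁) , (i₂ , j₂))) ≡ 0
indicator-nestingᵇ-≡0 {i₁} {j₁} {i₂} {j₂} j₁<j₂ =
  indicator-¬T (λ t → <-asym j₁<j₂ (proj₂ (proj₂ (Equivalence.to (T-<ᵇ³ i₁ i₂ i₂ j₂ j₂ j₁) t))))

module ArcPatternCount {f : Arc × Arc → Bool} (isPattern : IsArcPattern f) where
  open IsArcPattern isPattern
  open ≡-Reasoning

  count : Partition → ℕ
  count π = length (filterᵇ f (cartesianProduct (arcs π) (arcs π)))

  count≡pairCount : ∀ π → count π ≡ pairCount f (arcs π) (arcs π)
  count≡pairCount π = length-filter-cartesianProduct f (arcs π) (arcs π)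

  -- the pairs that the arc (1, m + 1) added by ext forms with the shifted arcs of π
  newArcCount : ℕ → Partition → ℕ
  newArcCount m π = rowCount f (1 , suc m) (map shiftArc (arcs π))

  count-ext-zero : ∀ π → count (ext 0 π) ≡ count π
  count-ext-zero π = begin
    count (ext 0 π)
      ≡⟨ count≡pairCount (ext 0 π) ⟩
    pairCount f (arcs (shift π)) (arcs (shift π))
      ≡⟨ cong (λ as → pairCount f as as) (arcs-shift π) ⟩
    pairCount f (map shiftArc (arcs π)) (map shiftArc (arcs π))
      ≡⟨ pairCount-map f shiftArc shift-invariant (arcs π) (arcs π) ⟩
    pairCount f (arcs π) (arcs π)
      ≡⟨ count≡pairCount π ⟨
    count π ∎

  ¬T-second-starts-at-1 : ∀ {x y} j → ¬ T (f ((suc x , y) , (1 , j)))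
  ¬T-second-starts-at-1 j t with proj₁ (interleaving t)
  ... | s≤s ()

  count-ext-suc : ∀ i π {m t} → nthBlock i π ≡ m ∷ t → count (ext (suc i) π) ≡ newArcCount m π + count π
  count-ext-suc i π {m} eq = begin
    count (ext (suc i) π)
      ≡⟨ count≡pairCount (ext (suc i) π) ⟩
    pairCount f (arcs (ext (suc i) π)) (arcs (ext (suc i) π))
      ≡⟨ pairCount-↭ f (arcs-ext-suc i π eq) ⟩
    pairCount f (a ∷ as) (a ∷ as)
      ≡⟨ pairCount-prepend f never-second ⟩
    rowCount f a as + pairCount f as as
      ≡⟨ cong (rowCount f a as +_) (pairCount-map f shiftArc shift-invariant (arcs π) (arcs π)) ⟩
    newArcCount m π + pairCount f (arcs π) (arcs π)
      ≡⟨ cong (newArcCount m π +_) (count≡pairCount π) ⟨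
    newArcCount m π + count π ∎
    where
    a = (1 , suc m)
    as = map shiftArc (arcs π)
    never-second : All (λ q → ¬ T (f (q , a))) (a ∷ as)
    never-second = ¬T-second-starts-at-1 (suc m)
                 ∷ All.map⁺ (All.universal (λ _ → ¬T-second-starts-at-1 (suc m)) (arcs π))

  newArcCount-≤-starts : ∀ {m} π → All ((m ≤_) ∘ proj₁) (arcs π) → newArcCount m π ≡ 0
  newArcCount-≤-starts _ m≤starts =
    rowCount-none f (All.map⁺ (All.map (λ m≤i t → <⇒≱ (proj₂ (interleaving t)) (s≤s m≤i)) m≤starts))

  newArcCount-one : ∀ π → newArcCount 1 π ≡ 0
  newArcCount-one π = rowCount-none f (All.map⁺ (All.universal nothing-inside (arcs π)))
    where
    nothing-inside : ∀ q → ¬ T (f ((1 , 2) , shiftArc q))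
    nothing-inside q t with interleaving t
    ... | s≤s (s≤s 1≤i) , s≤s (s≤s i<1) = <⇒≱ i<1 1≤i

  count-ext-one : ∀ π {m t} → nthBlock 0 π ≡ m ∷ t → newArcCount m π ≡ 0 → count (ext 1 π) ≡ count π
  count-ext-one π eq none = trans (count-ext-suc 0 π eq) (cong (_+ count π) none)

  count-ext-one-ext : ∀ i π → count (ext 1 (ext i π)) ≡ count (ext i π)
  count-ext-one-ext zero    π = count-ext-one (ext 0 π) refl (newArcCount-one (ext 0 π))
  count-ext-one-ext (suc i) π = count-ext-one (ext (suc i) π) refl (newArcCount-one (ext (suc i) π))

  rowCount-shift² : ∀ {m as} → All ((1 ≤_) ∘ proj₁) as →
    rowCount f (1 , 2 + m) (map shiftArc (map shiftArc as)) ≡ rowCount f (1 , suc m) (map shiftArc as)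
  rowCount-shift² {as = []} [] = refl
  rowCount-shift² {m} {as = (suc x , y) ∷ as} (_ ∷ pos) = cong₂ _+_
    (cong indicator (trans (start-relative (2 + m) x (2 + y))
                           (shift-invariant (1 , suc m) (2 + x , suc y))))
    (rowCount-shift² pos)

  newArcCount-ext-zero : ∀ m π → All ((1 ≤_) ∘ proj₁) (arcs π) →
                         newArcCount (suc m) (ext 0 π) ≡ newArcCount m π
  newArcCount-ext-zero m π pos =
    trans (cong (λ as → rowCount f (1 , 2 + m) (map shiftArc as)) (arcs-shift π)) (rowCount-shift² pos)

  newArcCount-ext-suc : ∀ m' i π {m t} → All ((1 ≤_) ∘ proj₁) (arcs π) → nthBlock i π ≡ m ∷ t →
    newArcCount (suc m') (ext (suc i) π) ≡ indicator (f ((1 , 2 + m') , (2 , 2 + m))) + newArcCount m' π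
  newArcCount-ext-suc m' i π {m} pos eq =
    trans (rowCount-↭ f (1 , 2 + m') (↭.map⁺ shiftArc (arcs-ext-suc i π eq)))
          (cong (indicator (f ((1 , 2 + m') , (2 , 2 + m))) +_) (rowCount-shift² pos))

  count-ext-ext-zero : ∀ k π {m t} → All ((1 ≤_) ∘ proj₁) (arcs π) → nthBlock k π ≡ m ∷ t →
    count (ext (2 + k) (ext 0 π)) ≡ count (ext (1 + k) π)
  count-ext-ext-zero k π {m} pos eq = begin
    count (ext (2 + k) (ext 0 π))
      ≡⟨ count-ext-suc (suc k) (ext 0 π) (trans (nthBlock-shift k π) (cong (map suc) eq)) ⟩
    newArcCount (suc m) (ext 0 π) + count (ext 0 π)
      ≡⟨ cong₂ _+_ (newArcCount-ext-zero m π pos) (count-ext-zero π) ⟩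
    newArcCount m π + count π
      ≡⟨ count-ext-suc k π eq ⟨
    count (ext (1 + k) π) ∎

  count-ext-ext-suc : ∀ i k k' π {m m' t t' t''} → All ((1 ≤_) ∘ proj₁) (arcs π) →
    nthBlock i π ≡ m ∷ t → nthBlock k (removeBlock i π) ≡ m' ∷ t' → nthBlock k' π ≡ m' ∷ t'' →
    count (ext (2 + k) (ext (1 + i) π)) + count π
      ≡ (count (ext (1 + i) π) + count (ext (1 + k') π)) + indicator (f ((1 , 2 + m') , (2 , 2 + m)))
  count-ext-ext-suc i k k' π {m} {m'} {t' = t'} pos eq eq' eq'' = begin
    count (ext (2 + k) ρ) + count π
      ≡⟨ cong (_+ count π) (count-ext-suc (suc k) ρ joined) ⟩
    (newArcCount (suc m') ρ + count ρ) + count π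
      ≡⟨ cong (λ n → (n + count ρ) + count π) (newArcCount-ext-suc m' i π pos eq) ⟩
    ((b + newArcCount m' π) + count ρ) + count π
      ≡⟨ rearrange b (newArcCount m' π) (count ρ) (count π) ⟩
    (count ρ + (newArcCount m' π + count π)) + b
      ≡⟨ cong (λ n → (count ρ + n) + b) (count-ext-suc k' π eq'') ⟨
    (count ρ + count (ext (1 + k') π)) + b ∎
    where
    ρ = ext (1 + i) π
    b = indicator (f ((1 , 2 + m') , (2 , 2 + m)))
    joined : nthBlock (suc k) ρ ≡ suc m' ∷ map suc t'
    joined = trans (nthBlock-shift k (removeBlock i π)) (cong (map suc) eq')
    rearrange : ∀ b r c d → ((b + r) + c) + d ≡ (c + (r + d)) + b
    rearrange = solve-∀

module Cr = ArcPatternCount crossing-isArcPattern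
module Ne = ArcPatternCount nesting-isArcPattern

module Weight {c ℓ : Level} (G : AbelianGroup c ℓ) (α β : AbelianGroup.Carrier G) where
  open AbelianGroup G renaming (sym to ≈-sym; trans to ≈-trans)
  open import Algebra.Properties.CommutativeSemigroup commutativeSemigroup
    using (interchange; xy∙z≈xz∙y)
  open import Algebra.Properties.Group group using (//-rightDividesʳ)
  open import Relation.Binary.Reasoning.Setoid setoid

  weight : ℕ → ℕ → Carrier
  weight a b = times G a α ∙ times G b β

  times-+ : ∀ m n x → times G (m + n) x ≈ times G m x ∙ times G n x
  times-+ zero    n x = ≈-sym (identityˡ _)
  times-+ (suc m) n x = ≈-trans (∙-congˡ (times-+ m n x)) (≈-sym (assoc _ _ _))

  weight-+ : ∀ a b c d → weight (a + c) (b + d) ≈ weight a b ∙ weight c d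
  weight-+ a b c d = ≈-trans (∙-cong (times-+ a c α) (times-+ b d β)) (interchange _ _ _ _)

  weight-balance : ∀ {a a₁ a₂ a₃ a₄ b b₁ b₂ b₃ b₄} →
                   a + a₁ ≡ (a₂ + a₃) + a₄ → b + b₁ ≡ (b₂ + b₃) + b₄ →
                   weight a b ≈ ((weight a₂ b₂ ∙ weight a₃ b₃) ∙ weight a₁ b₁ ⁻¹) ∙ weight a₄ b₄
  weight-balance {a} {a₁} {a₂} {a₃} {a₄} {b} {b₁} {b₂} {b₃} {b₄} ea eb = begin
    weight a b
      ≈⟨ //-rightDividesʳ (weight a₁ b₁) (weight a b) ⟨
    (weight a b ∙ weight a₁ b₁) ∙ weight a₁ b₁ ⁻¹
      ≈⟨ ∙-congʳ (weight-+ a b a₁ b₁) ⟨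
    weight (a + a₁) (b + b₁) ∙ weight a₁ b₁ ⁻¹
      ≡⟨ cong₂ (λ x y → weight x y ∙ weight a₁ b₁ ⁻¹) ea eb ⟩
    weight ((a₂ + a₃) + a₄) ((b₂ + b₃) + b₄) ∙ weight a₁ b₁ ⁻¹
      ≈⟨ ∙-congʳ (≈-trans (weight-+ (a₂ + a₃) (b₂ + b₃) a₄ b₄) (∙-congʳ (weight-+ a₂ b₂ a₃ b₃))) ⟩
    ((weight a₂ b₂ ∙ weight a₃ b₃) ∙ weight a₄ b₄) ∙ weight a₁ b₁ ⁻¹
      ≈⟨ xy∙z≈xz∙y _ _ _ ⟩
    ((weight a₂ b₂ ∙ weight a₃ b₃) ∙ weight a₁ b₁ ⁻¹) ∙ weight a₄ b₄ ∎

  weight-α : weight 1 0 ≈ α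
  weight-α = ≈-trans (identityʳ _) (identityʳ α)

  weight-β : weight 0 1 ≈ β
  weight-β = ≈-trans (identityˡ _) (identityʳ β)

module Extension {c ℓ : Level} (G : AbelianGroup c ℓ) (α β : AbelianGroup.Carrier G) where
  open AbelianGroup G renaming (refl to ≈-refl; sym to ≈-sym; trans to ≈-trans)
  open Weight G α β
  open import Relation.Binary.Reasoning.Setoid setoid

  s-cong : ∀ X Y → cr X ≡ cr Y → ne X ≡ ne Y → s G α β X ≈ s G α β Y
  s-cong _ _ eC eN = reflexive (cong₂ weight eC eN)

  s-balance : ∀ X Y Z W {a b} → cr X + cr W ≡ (cr Y + cr Z) + a → ne X + ne W ≡ (ne Y + ne Z) + b →
              s G α β X ≈ ((s G α β Y ∙ s G α β Z) ∙ s G α β W ⁻¹) ∙ weight a b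
  s-balance X Y Z W {a} {b} = weight-balance {cr X} {cr W} {cr Y} {cr Z} {a} {ne X} {ne W} {ne Y} {ne Z} {b}

  s-ext-zero : ∀ π → s G α β (ext 0 π) ≈ s G α β π
  s-ext-zero π = s-cong (ext 0 π) π (Cr.count-ext-zero π) (Ne.count-ext-zero π)

  s-ext-low : ∀ i π {j} → j ≤ 1 → s G α β (ext j (ext i π)) ≈ s G α β (ext i π)
  s-ext-low i π {zero}        _        = s-ext-zero (ext i π)
  s-ext-low i π {suc zero}    _        =
    s-cong (ext 1 (ext i π)) (ext i π) (Cr.count-ext-one-ext i π) (Ne.count-ext-one-ext i π)
  s-ext-low i π {suc (suc _)} (s≤s ())

  s-ext-one : ∀ {n π} → IsPartition n π → s G α β (ext 1 π) ≈ s G α β π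
  s-ext-one {π = []}              _  = ≈-refl
  s-ext-one {π = [] ∷ _}          ip = contradiction refl (All.head (IsPartition.nonempty ip))
  s-ext-one {π = π@((m ∷ _) ∷ _)} ip =
    s-cong (ext 1 π) π (Cr.count-ext-one π refl (Cr.newArcCount-≤-starts π starts))
                       (Ne.count-ext-one π refl (Ne.newArcCount-≤-starts π starts))
    where
    open IsPartition ip
    starts : All ((m ≤_) ∘ proj₁) (arcs π)
    starts = All-arcs-start (elements-≥-first increasing ordered)

  s-ext-ext-zero : ∀ {n π k} → IsPartition n π → k < length π →
                   s G α β (ext (2 + k) (ext 0 π)) ≈ s G α β (ext (1 + k) π)
  s-ext-ext-zero {π = π} {k} ip k<len with nthBlock-nonempty (IsPartition.nonempty ip) k<len
  ... | _ , _ , eq = s-cong (ext (2 + k) (ext 0 π)) (ext (1 + k) π)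
                            (Cr.count-ext-ext-zero k π pos eq) (Ne.count-ext-ext-zero k π pos eq)
    where pos = All-arcs-start (elements-positive ip)

  s-ext-ext-suc : ∀ {n π} i k k' {m m' t t' t''} → IsPartition n π →
    nthBlock i π ≡ m ∷ t → nthBlock k (removeBlock i π) ≡ m' ∷ t' → nthBlock k' π ≡ m' ∷ t'' →
    s G α β (ext (2 + k) (ext (1 + i) π))
      ≈ ((s G α β (ext (1 + i) π) ∙ s G α β (ext (1 + k') π)) ∙ s G α β (ext 1 π) ⁻¹)
          ∙ weight (indicator (crossingᵇ ((1 , 2 + m') , (2 , 2 + m))))
                   (indicator (nestingᵇ ((1 , 2 + m') , (2 , 2 + m))))
  s-ext-ext-suc {π = π} i k k' {m} {m'} ip eq eq' eq'' = begin
    s G α β (ext (2 + k) (ext (1 + i) π))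
      ≈⟨ s-balance (ext (2 + k) (ext (1 + i) π)) (ext (1 + i) π) (ext (1 + k') π) π
                   (Cr.count-ext-ext-suc i k k' π pos eq eq' eq'')
                   (Ne.count-ext-ext-suc i k k' π pos eq eq' eq'') ⟩
    ((s G α β (ext (1 + i) π) ∙ s G α β (ext (1 + k') π)) ∙ s G α β π ⁻¹) ∙ weight cb nb
      ≈⟨ ∙-congʳ (∙-congˡ (⁻¹-cong (≈-sym (s-ext-one ip)))) ⟩
    ((s G α β (ext (1 + i) π) ∙ s G α β (ext (1 + k') π)) ∙ s G α β (ext 1 π) ⁻¹) ∙ weight cb nb ∎
    where
    pos = All-arcs-start (elements-positive ip)
    cb = indicator (crossingᵇ ((1 , 2 + m') , (2 , 2 + m)))
    nb = indicator (nestingᵇ ((1 , 2 + m') , (2 , 2 + m)))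

  s-ext-ext-before : ∀ {n π i k} → IsPartition n π → k < i → i < length π →
    s G α β (ext (2 + k) (ext (1 + i) π))
      ≈ ((s G α β (ext (1 + i) π) ∙ s G α β (ext (1 + k) π)) ∙ s G α β (ext 1 π) ⁻¹) ∙ α
  s-ext-ext-before {π = π} {i} {k} ip k<i i<len
    with nthBlock-nonempty (IsPartition.nonempty ip) i<len
       | nthBlock-nonempty (IsPartition.nonempty ip) (<-trans k<i i<len)
  ... | m , _ , eq | m' , _ , eq' =
    ≈-trans (s-ext-ext-suc i k k ip eq (trans (nthBlock-removeBlock-< π k<i) eq') eq')
            (∙-congˡ (≈-trans (reflexive (cong₂ weight crossing nesting)) weight-α))
    where
    m'<m = nthBlock-head-< (IsPartition.ordered ip) k<i eq' eq
    crossing : indicator (crossingᵇ ((1 , 2 + m') , (2 , 2 + m))) ≡ 1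
    crossing = indicator-crossingᵇ-≡1 {i₁ = 1} {i₂ = 2}
                 (s≤s (s≤s z≤n)) (s≤s (s≤s (nthBlock-head-positive ip eq'))) (s≤s (s≤s m'<m))
    nesting : indicator (nestingᵇ ((1 , 2 + m') , (2 , 2 + m))) ≡ 0
    nesting = indicator-nestingᵇ-≡0 {i₁ = 1} {i₂ = 2} (s≤s (s≤s m'<m))

  s-ext-ext-after : ∀ {n π i k} → IsPartition n π → i ≤ k → 1 + k < length π →
    s G α β (ext (2 + k) (ext (1 + i) π))
      ≈ ((s G α β (ext (1 + i) π) ∙ s G α β (ext (2 + k) π)) ∙ s G α β (ext 1 π) ⁻¹) ∙ β
  s-ext-ext-after {π = π} {i} {k} ip i≤k k<len
    with nthBlock-nonempty (IsPartition.nonempty ip) (≤-trans (s≤s (m≤n⇒m≤1+n i≤k)) k<len)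
       | nthBlock-nonempty (IsPartition.nonempty ip) k<len
  ... | m , _ , eq | m' , _ , eq' =
    ≈-trans (s-ext-ext-suc i k (suc k) ip eq (trans (nthBlock-removeBlock-≥ π i≤k) eq') eq')
            (∙-congˡ (≈-trans (reflexive (cong₂ weight crossing nesting)) weight-β))
    where
    m<m' = nthBlock-head-< (IsPartition.ordered ip) (s≤s i≤k) eq eq'
    crossing : indicator (crossingᵇ ((1 , 2 + m') , (2 , 2 + m))) ≡ 0
    crossing = indicator-crossingᵇ-≡0 {i₁ = 1} {i₂ = 2} (s≤s (s≤s m<m'))
    nesting : indicator (nestingᵇ ((1 , 2 + m') , (2 , 2 + m))) ≡ 1
    nesting = indicator-nestingᵇ-≡1 {i₁ = 1} {i₂ = 2}
                (s≤s (s≤s z≤n)) (s≤s (s≤s (nthBlock-head-positive ip eq))) (s≤s (s≤s m<m'))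

lemma2p1 : {c ℓ : Level} (G : AbelianGroup c ℓ) →
  let open AbelianGroup G in
  (α β : Carrier) (n : ℕ) (λ₀ : Partition) →
  IsPartition n λ₀ → 1 ≤ length λ₀ →
  ((j : ℕ) → j ≤ 1 →
     s G α β (ext j (ext 0 λ₀)) ≈ s G α β λ₀)
  × ((j : ℕ) → 2 ≤ j → j ≤ suc (length λ₀) →
     s G α β (ext j (ext 0 λ₀)) ≈ s G α β (ext (j ∸ 1) λ₀))
  × ((i j : ℕ) → 1 ≤ i → i ≤ length λ₀ → j ≤ 1 →
     s G α β (ext j (ext i λ₀)) ≈ s G α β (ext i λ₀))
  × ((i j : ℕ) → 1 ≤ i → i ≤ length λ₀ → 2 ≤ j → j ≤ i →
     s G α β (ext j (ext i λ₀))
       ≈ (((s G α β (ext i λ₀) ∙ s G α β (ext (j ∸ 1) λ₀))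
            ∙ (s G α β (ext 1 λ₀)) ⁻¹) ∙ α))
  × ((i j : ℕ) → 1 ≤ i → i ≤ length λ₀ → suc i ≤ j → j ≤ length λ₀ →
     s G α β (ext j (ext i λ₀))
       ≈ (((s G α β (ext i λ₀) ∙ s G α β (ext j λ₀))
            ∙ (s G α β (ext 1 λ₀)) ⁻¹) ∙ β))
lemma2p1 G α β n λ₀ ip _ = zero-low , zero-high , suc-low , suc-before , suc-after
  where
  open AbelianGroup G using (_≈_; _∙_; _⁻¹) renaming (trans to ≈-trans)
  open Extension G α β

  zero-low : ∀ j → j ≤ 1 → s G α β (ext j (ext 0 λ₀)) ≈ s G α β λ₀
  zero-low j j≤1 = ≈-trans (s-ext-low 0 λ₀ j≤1) (s-ext-zero λ₀)

  zero-high : ∀ j → 2 ≤ j → j ≤ suc (length λ₀) →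
              s G α β (ext j (ext 0 λ₀)) ≈ s G α β (ext (j ∸ 1) λ₀)
  zero-high (suc zero)    (s≤s ()) _
  zero-high (suc (suc k)) _        (s≤s k<len) = s-ext-ext-zero ip k<len

  suc-low : ∀ i j → 1 ≤ i → i ≤ length λ₀ → j ≤ 1 →
            s G α β (ext j (ext i λ₀)) ≈ s G α β (ext i λ₀)
  suc-low i j _ _ = s-ext-low i λ₀

  suc-before : ∀ i j → 1 ≤ i → i ≤ length λ₀ → 2 ≤ j → j ≤ i →
    s G α β (ext j (ext i λ₀))
      ≈ ((s G α β (ext i λ₀) ∙ s G α β (ext (j ∸ 1) λ₀)) ∙ s G α β (ext 1 λ₀) ⁻¹) ∙ α
  suc-before (suc i) (suc zero)    _ _     (s≤s ()) _
  suc-before (suc i) (suc (suc k)) _ i<len _        (s≤s k<i) = s-ext-ext-before ip k<i i<len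

  suc-after : ∀ i j → 1 ≤ i → i ≤ length λ₀ → suc i ≤ j → j ≤ length λ₀ →
    s G α β (ext j (ext i λ₀))
      ≈ ((s G α β (ext i λ₀) ∙ s G α β (ext j λ₀)) ∙ s G α β (ext 1 λ₀) ⁻¹) ∙ β
  suc-after (suc i) (suc (suc k)) _ _ (s≤s (s≤s i≤k)) k<len = s-ext-ext-after ip i≤k k<len
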